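{- Let $m\ge0$ and let $n$ be an integer with $2^m\le n<2^{m+1}$, with binary representation $n=\sum_{k=0}^m\varepsilon_k2^k$, $\varepsilon_k\in\{0,1\}$ (so $\varepsilon_m=1$). Define $$h(n)=\sum_{k=0}^{m-1}(1-\varepsilon_k)\left\lfloor\frac{n}{2^{k+1}}\right\rfloor.$$ Then $0\le h(n)\le n-1$. Moreover, $h(n)=0$ if and only if $n=2^{m+1}-1$, and $h(n)=n-1$ if and only if $n=2^m$.
   Context: $\lfloor\cdot\rfloor$ is the floor function. -}

module Defs where

open import Data.Nat using (ℕ; zero; suc; _+_; _*_; _∸_; _^_)
open import Data.Nat.DivMod using (_/_; _%_)
open import Data.Nat.Properties using (m^n≢0)

digit : ℕ → ℕ → ℕ
digit n k = (_/_ n (2 ^ k) {{m^n≢0 2 k}}) % 2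

sumBelow : ℕ → (ℕ → ℕ) → ℕ
sumBelow zero    f = 0
sumBelow (suc m) f = sumBelow m f + f m

h : ℕ → ℕ → ℕ
h m n = sumBelow m (λ k → (1 ∸ digit n k) * (_/_ n (2 ^ suc k) {{m^n≢0 2 (suc k)}}))

{-# OPTIONS --safe #-}
-- Splitting off the lowest binary digit of n = 2q + ε₀ gives the recursion
-- h(m+1, 2q) = q + h(m, q) and h(m+1, 2q+1) = h(m, q), with h(0, 1) = 0.
-- All three claims follow by induction on m along this recursion: a digit 0
-- contributes q ≥ 1 to h, a digit 1 contributes nothing, so h vanishes exactly
-- when every digit is 1 and attains 2q - 1 exactly when every lower digit is 0.
module Submission where

open import Defs
open import Data.Nat using (ℕ; zero; suc; _+_; _*_; _∸_; _^_; _≤_; _<_; z≤n; s≤s; NonZero)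
open import Data.Nat.Properties
open import Data.Nat.DivMod
open import Data.Nat.Divisibility using (divides-refl)
open import Data.Product using (_×_; _,_)
open import Data.Sum using (_⊎_; inj₁; inj₂)
open import Function.Base using (_∘_)
open import Function.Bundles using (_⇔_; mk⇔)
open import Function.Properties.Equivalence using () renaming (trans to ⇔-trans)
open import Relation.Nullary using (¬_; contradiction)
open import Relation.Binary.PropositionalEquality

sumBelow-suc : ∀ m f → sumBelow (suc m) f ≡ f 0 + sumBelow m (f ∘ suc)
sumBelow-suc zero    f = sym (+-identityʳ (f 0))
sumBelow-suc (suc m) f = begin
  sumBelow (suc m) f + f (suc m)                ≡⟨ cong (_+ f (suc m)) (sumBelow-suc m f) ⟩
  f 0 + sumBelow m (f ∘ suc) + f (suc m)        ≡⟨ +-assoc (f 0) _ _ ⟩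
  f 0 + (sumBelow m (f ∘ suc) + f (suc m))      ∎
  where open ≡-Reasoning

sumBelow-cong : ∀ m {f g} → (∀ k → f k ≡ g k) → sumBelow m f ≡ sumBelow m g
sumBelow-cong zero    f≗g = refl
sumBelow-cong (suc m) f≗g = cong₂ _+_ (sumBelow-cong m f≗g) (f≗g m)

m/2^[1+k]≡m/2/2^k : ∀ n k → _/_ n (2 ^ suc k) {{m^n≢0 2 (suc k)}} ≡ _/_ (n / 2) (2 ^ k) {{m^n≢0 2 k}}
m/2^[1+k]≡m/2/2^k n k = sym (m/n/o≡m/[n*o] n 2 (2 ^ k) {{_}} {{m^n≢0 2 k}} {{m^n≢0 2 (suc k)}})

h-suc : ∀ m n → h (suc m) n ≡ (1 ∸ n % 2) * (n / 2) + h m (n / 2)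
h-suc m n = begin
  h (suc m) n
    ≡⟨ sumBelow-suc m _ ⟩
  (1 ∸ digit n 0) * (n / 2) + sumBelow m _
    ≡⟨ cong₂ (λ a s → (1 ∸ a % 2) * (n / 2) + s) (n/1≡n n) (sumBelow-cong m shift) ⟩
  (1 ∸ n % 2) * (n / 2) + h m (n / 2) ∎
  where
  open ≡-Reasoning
  shift : ∀ k → (1 ∸ digit n (suc k)) * _/_ n (2 ^ suc (suc k)) {{m^n≢0 2 (suc (suc k))}}
              ≡ (1 ∸ digit (n / 2) k) * _/_ (n / 2) (2 ^ suc k) {{m^n≢0 2 (suc k)}}
  shift k = cong₂ (λ a b → (1 ∸ a % 2) * b) (m/2^[1+k]≡m/2/2^k n k) (m/2^[1+k]≡m/2/2^k n (suc k))

[2*q]%2≡0 : ∀ q → (2 * q) % 2 ≡ 0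
[2*q]%2≡0 q = trans (cong (_% 2) (*-comm 2 q)) (m*n%n≡0 q 2)

[2*q]/2≡q : ∀ q → (2 * q) / 2 ≡ q
[2*q]/2≡q q = trans (cong (_/ 2) (*-comm 2 q)) (m*n/n≡m q 2)

[1+2*q]%2≡1 : ∀ q → suc (2 * q) % 2 ≡ 1
[1+2*q]%2≡1 q = trans (cong (λ x → suc x % 2) (*-comm 2 q)) ([m+kn]%n≡m%n 1 q 2)

[1+2*q]/2≡q : ∀ q → suc (2 * q) / 2 ≡ q
[1+2*q]/2≡q q = begin
  suc (2 * q) / 2   ≡⟨ cong (λ x → suc x / 2) (*-comm 2 q) ⟩
  (1 + q * 2) / 2   ≡⟨ +-distrib-/-∣ʳ 1 {q * 2} {2} (divides-refl q) ⟩
  q * 2 / 2         ≡⟨ m*n/n≡m q 2 ⟩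
  q                 ∎
  where open ≡-Reasoning

h-suc-double : ∀ m q → h (suc m) (2 * q) ≡ q + h m q
h-suc-double m q = begin
  h (suc m) (2 * q)                                                ≡⟨ h-suc m (2 * q) ⟩
  (1 ∸ (2 * q) % 2) * ((2 * q) / 2) + h m ((2 * q) / 2)            ≡⟨ cong₂ (λ r d → (1 ∸ r) * d + h m d) ([2*q]%2≡0 q) ([2*q]/2≡q q) ⟩
  1 * q + h m q                                                    ≡⟨ cong (_+ h m q) (*-identityˡ q) ⟩
  q + h m q                                                        ∎
  where open ≡-Reasoning

h-suc-double+1 : ∀ m q → h (suc m) (suc (2 * q)) ≡ h m q
h-suc-double+1 m q = begin
  h (suc m) (suc (2 * q))                                          ≡⟨ h-suc m (suc (2 * q)) ⟩
  (1 ∸ suc (2 * q) % 2) * (suc (2 * q) / 2) + h m (suc (2 * q) / 2) ≡⟨ cong₂ (λ r d → (1 ∸ r) * d + h m d) ([1+2*q]%2≡1 q) ([1+2*q]/2≡q q) ⟩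
  h m q                                                            ∎
  where open ≡-Reasoning

n≡2*[n/2]⊎n≡1+2*[n/2] : ∀ n → n ≡ 2 * (n / 2) ⊎ n ≡ suc (2 * (n / 2))
n≡2*[n/2]⊎n≡1+2*[n/2] n with n % 2 | m≡m%n+[m/n]*n n 2 | m%n<n n 2
... | 0           | n≡ | _ = inj₁ (trans n≡ (*-comm (n / 2) 2))
... | 1           | n≡ | _ = inj₂ (trans n≡ (cong suc (*-comm (n / 2) 2)))
... | suc (suc _) | _  | s≤s (s≤s ())

2^m≤n/2 : ∀ m n → 2 ^ suc m ≤ n → 2 ^ m ≤ n / 2
2^m≤n/2 m n lo = begin
  2 ^ m             ≡⟨ m*n/n≡m (2 ^ m) 2 ⟨
  2 ^ m * 2 / 2     ≤⟨ /-monoˡ-≤ 2 (≤-trans (≤-reflexive (*-comm (2 ^ m) 2)) lo) ⟩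
  n / 2             ∎
  where open ≤-Reasoning

n/2<2^[1+m] : ∀ m n → n < 2 ^ suc (suc m) → n / 2 < 2 ^ suc m
n/2<2^[1+m] m n hi = m<n*o⇒m/o<n (≤-trans hi (≤-reflexive (*-comm 2 (2 ^ suc m))))

module _ (P : ℕ → ℕ → Set) (base : P 0 1)
         (double   : ∀ m q → 2 ^ m ≤ q → q < 2 ^ suc m → P m q → P (suc m) (2 * q))
         (double+1 : ∀ m q → 2 ^ m ≤ q → q < 2 ^ suc m → P m q → P (suc m) (suc (2 * q))) where

  binary-induction : ∀ m n → 2 ^ m ≤ n → n < 2 ^ suc m → P m n
  binary-induction zero n lo hi = subst (P 0) (≤-antisym lo (≤-pred hi)) base
  binary-induction (suc m) n lo hi
    with 2^m≤n/2 m n lo | n/2<2^[1+m] m n hi | n≡2*[n/2]⊎n≡1+2*[n/2] n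
  ... | qlo | qhi | inj₁ n≡2q   =
    subst (P (suc m)) (sym n≡2q) (double m (n / 2) qlo qhi (binary-induction m (n / 2) qlo qhi))
  ... | qlo | qhi | inj₂ n≡1+2q =
    subst (P (suc m)) (sym n≡1+2q) (double+1 m (n / 2) qlo qhi (binary-induction m (n / 2) qlo qhi))

2*q∸1≡q+[q∸1] : ∀ q → 2 * q ∸ 1 ≡ q + (q ∸ 1)
2*q∸1≡q+[q∸1] zero    = refl
2*q∸1≡q+[q∸1] (suc q) = trans (cong (λ x → q + suc x) (+-identityʳ q)) (+-suc q q)

q∸1<2*q : ∀ {q} → 0 < q → q ∸ 1 < 2 * q
q∸1<2*q {suc q} _ = s≤s (m≤m+n q _)

≡⇔2*≡2* : ∀ {m n} → (m ≡ n) ⇔ (2 * m ≡ 2 * n)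
≡⇔2*≡2* = mk⇔ (cong (2 *_)) (*-cancelˡ-≡ _ _ 2)

¬×¬⇒⇔ : ∀ {A B : Set} → ¬ A → ¬ B → A ⇔ B
¬×¬⇒⇔ ¬a ¬b = mk⇔ (λ a → contradiction a ¬a) (λ b → contradiction b ¬b)

h≤n∸1 : ∀ m n → 2 ^ m ≤ n → n < 2 ^ suc m → h m n ≤ n ∸ 1
h≤n∸1 = binary-induction (λ m n → h m n ≤ n ∸ 1) z≤n double double+1
  where
  double : ∀ m q → 2 ^ m ≤ q → q < 2 ^ suc m → h m q ≤ q ∸ 1 → h (suc m) (2 * q) ≤ 2 * q ∸ 1
  double m q _ _ ih rewrite h-suc-double m q | 2*q∸1≡q+[q∸1] q = +-monoʳ-≤ q ih
  double+1 : ∀ m q → 2 ^ m ≤ q → q < 2 ^ suc m → h m q ≤ q ∸ 1 → h (suc m) (suc (2 * q)) ≤ 2 * q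
  double+1 m q _ _ ih rewrite h-suc-double+1 m q = ≤-trans ih (≤-trans (m∸n≤m q 1) (m≤m+n q _))

h≡0⇔1+n≡2^[1+m] : ∀ m n → 2 ^ m ≤ n → n < 2 ^ suc m → (h m n ≡ 0) ⇔ (suc n ≡ 2 ^ suc m)
h≡0⇔1+n≡2^[1+m] = binary-induction (λ m n → (h m n ≡ 0) ⇔ (suc n ≡ 2 ^ suc m))
  (mk⇔ (λ _ → refl) (λ _ → refl)) double double+1
  where
  double : ∀ m q → 2 ^ m ≤ q → q < 2 ^ suc m → (h m q ≡ 0) ⇔ (suc q ≡ 2 ^ suc m) →
           (h (suc m) (2 * q) ≡ 0) ⇔ (suc (2 * q) ≡ 2 ^ suc (suc m))
  double m q lo _ _ rewrite h-suc-double m q = ¬×¬⇒⇔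
    (λ q+h≡0 → <⇒≢ (≤-trans (m^n>0 2 m) lo) (sym (m+n≡0⇒m≡0 q q+h≡0)))
    (λ e → even≢odd (2 ^ suc m) q (sym e))
  double+1 : ∀ m q → 2 ^ m ≤ q → q < 2 ^ suc m → (h m q ≡ 0) ⇔ (suc q ≡ 2 ^ suc m) →
             (h (suc m) (suc (2 * q)) ≡ 0) ⇔ (suc (suc (2 * q)) ≡ 2 ^ suc (suc m))
  double+1 m q _ _ ih rewrite h-suc-double+1 m q | sym (*-suc 2 q) = ⇔-trans ih ≡⇔2*≡2*

h≡n∸1⇔n≡2^m : ∀ m n → 2 ^ m ≤ n → n < 2 ^ suc m → (h m n ≡ n ∸ 1) ⇔ (n ≡ 2 ^ m)
h≡n∸1⇔n≡2^m = binary-induction (λ m n → (h m n ≡ n ∸ 1) ⇔ (n ≡ 2 ^ m))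
  (mk⇔ (λ _ → refl) (λ _ → refl)) double double+1
  where
  double : ∀ m q → 2 ^ m ≤ q → q < 2 ^ suc m → (h m q ≡ q ∸ 1) ⇔ (q ≡ 2 ^ m) →
           (h (suc m) (2 * q) ≡ 2 * q ∸ 1) ⇔ (2 * q ≡ 2 ^ suc m)
  double m q _ _ ih rewrite h-suc-double m q | 2*q∸1≡q+[q∸1] q =
    ⇔-trans (mk⇔ (+-cancelˡ-≡ q _ _) (cong (q +_))) (⇔-trans ih ≡⇔2*≡2*)
  double+1 : ∀ m q → 2 ^ m ≤ q → q < 2 ^ suc m → (h m q ≡ q ∸ 1) ⇔ (q ≡ 2 ^ m) →
             (h (suc m) (suc (2 * q)) ≡ 2 * q) ⇔ (suc (2 * q) ≡ 2 ^ suc m)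
  double+1 m q lo hi _ rewrite h-suc-double+1 m q = ¬×¬⇒⇔
    (<⇒≢ (≤-<-trans (h≤n∸1 m q lo hi) (q∸1<2*q (≤-trans (m^n>0 2 m) lo))))
    (λ e → even≢odd (2 ^ m) q (sym e))

1+n≡x⇔n≡x∸1 : ∀ {n} x .{{_ : NonZero x}} → (suc n ≡ x) ⇔ (n ≡ x ∸ 1)
1+n≡x⇔n≡x∸1 (suc x) = mk⇔ suc-injective (cong suc)

lemma1 : (m n : ℕ) → 2 ^ m ≤ n → n < 2 ^ suc m →
    (h m n ≤ n ∸ 1)
    × ((h m n ≡ 0) ⇔ (n ≡ 2 ^ suc m ∸ 1))
    × ((h m n ≡ n ∸ 1) ⇔ (n ≡ 2 ^ m))
lemma1 m n lo hi =
    h≤n∸1 m n lo hi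
  , ⇔-trans (h≡0⇔1+n≡2^[1+m] m n lo hi) (1+n≡x⇔n≡x∸1 (2 ^ suc m) {{m^n≢0 2 (suc m)}})
  , h≡n∸1⇔n≡2^m m n lo hi
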